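{- Let $\mathbb{F}$ be a field and $d \geq 2$. Let $P$ be a set of $n$ points in $\mathbb{F}^d$ such that no $s$ points of $P$ are contained in any single hyperplane, and no $t$ points of $P$ are contained in any single $(d-2)$-plane. Let $\alpha,\beta \in \mathbb{F} \setminus \{0\}$. Then \[|\Pi_{\alpha,\beta}(P)| \leq \min\big(2s^2n,\ O(tn^2)\big),\] where the implied constant is absolute.
   Context: For a field $\mathbb{F}$, a finite set $P \subseteq \mathbb{F}^d$ and $\alpha,\beta \in \mathbb{F}$, define $\Pi_{\alpha,\beta}(P) = \{(p,q,r) \in P \times P \times P \mid p \cdot q = \alpha,\ p \cdot r = \beta\}$, where $\cdot$ is the standard dot product. A $k$-plane is a $k$-dimensional affine subspace of $\mathbb{F}^d$; a hyperplane is a $(d-1)$-plane. "No $s$ points are contained in any hyperplane" means every hyperplane contains fewer than $s$ points of $P$, and similarly for $(d-2)$-planes and $t$. -}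

module Defs where

open import Level using (Level; _⊔_; Setω) renaming (suc to lsuc)
open import Data.Nat using (ℕ; zero; suc; _≤_; _<_)
open import Data.Fin using (Fin; zero; suc)
open import Data.List using (List; length)
open import Data.List.Relation.Unary.All using (All)
open import Data.List.Relation.Unary.Any using (Any)
open import Data.List.Relation.Unary.AllPairs using (AllPairs)
open import Data.Product using (Σ; ∃; _×_; _,_)
open import Relation.Nullary using (¬_)
open import Algebra.Bundles using (CommutativeRing)

record Field (c ℓ : Level) : Set (lsuc (c ⊔ ℓ)) where
  field
    commutativeRing : CommutativeRing c ℓ
  open CommutativeRing commutativeRing public
  field
    0≉1     : ¬ (0# ≈ 1#)
    inverse : ∀ x → ¬ (x ≈ 0#) → ∃ λ y → (x * y) ≈ 1#

-- Existential over ℕ whose body lives in Setω (needed so that the absolute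
-- constant C is chosen before quantifying over all fields of all levels).
record ∃ℕω (P : ℕ → Setω) : Setω where
  constructor _,ω_
  field
    witness : ℕ
    proof   : P witness

module _ {c ℓ : Level} (F : Field c ℓ) where
  open Field F using (Carrier; _≈_; _+_; _*_; 0#)

  Point : ℕ → Set c
  Point d = Fin d → Carrier

  _≈ᵖ_ : ∀ {d} → Point d → Point d → Set ℓ
  p ≈ᵖ q = ∀ i → p i ≈ q i

  sumF : ∀ {k} → (Fin k → Carrier) → Carrier
  sumF {zero}  f = 0#
  sumF {suc k} f = f zero + sumF (λ i → f (suc i))

  dot : ∀ {d} → Point d → Point d → Carrier
  dot p q = sumF (λ i → p i * q i)

  lincomb : ∀ {d k} → (Fin k → Carrier) → (Fin k → Point d) → Point d
  lincomb λs v i = sumF (λ j → λs j * v j i)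

  LinIndep : ∀ {d k} → (Fin k → Point d) → Set (c ⊔ ℓ)
  LinIndep {d} {k} v =
    ∀ (λs : Fin k → Carrier) → lincomb λs v ≈ᵖ (λ _ → 0#) → ∀ j → λs j ≈ 0#

  record Plane (d k : ℕ) : Set (c ⊔ ℓ) where
    field
      base  : Point d
      dir   : Fin k → Point d
      indep : LinIndep dir

  _∈Plane_ : ∀ {d k} → Point d → Plane d k → Set (c ⊔ ℓ)
  _∈Plane_ {d} {k} x H =
    Σ (Fin k → Carrier) λ λs → x ≈ᵖ (λ i → Plane.base H i + lincomb λs (Plane.dir H) i)

  _∈Set_ : ∀ {d} → Point d → List (Point d) → Set (c ⊔ ℓ)
  x ∈Set P = Any (λ y → x ≈ᵖ y) P

  DistinctPts : ∀ {d} → List (Point d) → Set (c ⊔ ℓ)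
  DistinctPts P = AllPairs (λ p q → ¬ (p ≈ᵖ q)) P

  FewerThanOnPlanes : ∀ {d} → List (Point d) → (k s : ℕ) → Set (c ⊔ ℓ)
  FewerThanOnPlanes {d} P k s =
    ∀ (H : Plane d k) (L : List (Point d)) → DistinctPts L →
      All (λ x → (x ∈Set P) × (x ∈Plane H)) L → length L < s

  Triple : ℕ → Set c
  Triple d = Point d × Point d × Point d

  _≈ᵗ_ : ∀ {d} → Triple d → Triple d → Set ℓ
  (p , q , r) ≈ᵗ (p' , q' , r') = (p ≈ᵖ p') × (q ≈ᵖ q') × (r ≈ᵖ r')

  InΠ : ∀ {d} → List (Point d) → Carrier → Carrier → Triple d → Set (c ⊔ ℓ)
  InΠ P α β (p , q , r) =
    (p ∈Set P) × (q ∈Set P) × (r ∈Set P) × (dot p q ≈ α) × (dot p r ≈ β)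

  CardΠ≤ : ∀ {d} → List (Point d) → Carrier → Carrier → ℕ → Set (c ⊔ ℓ)
  CardΠ≤ {d} P α β m =
    ∀ (L : List (Triple d)) → AllPairs (λ x y → ¬ (x ≈ᵗ y)) L →
      All (InΠ P α β) L → length L ≤ m

-- For fixed p, every q with p · q = α lies on the hyperplane {x | p · x = α} (p ≠ 0 as α ≠ 0),
-- which contains fewer than s points of P; likewise for r, so |Π_{α,β}(P)| ≤ n s².
-- For fixed (q, r), the points p with p · q = α and p · r = β lie on a (d − 2)-plane unless
-- r = (β/α) q.  In that case r is determined by q, so these triples number at most n², while
-- every other pair (q, r) carries fewer than t of them, whence |Π_{α,β}(P)| ≤ n² + n² (t − 1) = t n².
-- Hyperplanes are parametrised explicitly by solving for a coordinate with nonzero coefficient.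
-- Equality in F is undecidable, so case distinctions on field elements are made under a double
-- negation; this is harmless because every goal is an inequality between natural numbers.
module Submission where

open import Level using (Level; _⊔_)
open import Function using (_∘_)
import Data.Nat as ℕ
open ℕ using (ℕ; zero; suc; _≤_; _<_; pred; z≤n; s≤s⁻¹; _≤?_)
open import Data.Nat.Properties using (+-suc; +-mono-≤; ≤-<-connex; <⇒≤pred)
open import Data.Sum using (inj₁; inj₂)
open import Data.Fin using (Fin; zero; suc; toℕ; _↑ʳ_)
import Data.Fin.Properties as Finₚ
open import Data.Product using (Σ; ∃; _×_; _,_; proj₁; proj₂; uncurry)
open import Data.Product.Properties using (≡-dec)
open import Data.Unit using (⊤; tt)
open import Data.Empty using (⊥-elim)
open import Data.List using (List; []; _∷_; length; map; filter; lookup)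
open import Data.List.Properties using (length-map)
open import Data.List.Membership.Propositional.Properties using (∈-lookup)
import Data.List.Membership.Setoid.Properties as Membershipₛ
open import Data.List.Relation.Unary.All as All using (All; []; _∷_)
import Data.List.Relation.Unary.All.Properties as All
open import Data.List.Relation.Unary.All.Properties using (all-filter)
open import Data.List.Relation.Unary.Any using (index)
open import Data.List.Relation.Unary.Any.Properties using (lookup-index)
open import Data.List.Relation.Unary.AllPairs as AllPairs using (AllPairs; []; _∷_)
import Data.List.Relation.Unary.AllPairs.Properties as AllPairs
open import Data.List.Relation.Unary.Unique.Propositional using (Unique)
import Data.List.Relation.Unary.Unique.Propositional.Properties as Unique
open import Data.Vec.Functional.Relation.Binary.Equality.Setoid using (≋-setoid)
open import Relation.Nullary using (¬_; Dec; yes; no; ¬?)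
open import Relation.Nullary.Decidable using (decidable-stable; ¬¬-excluded-middle)
open import Relation.Unary using (Pred; Decidable; U)
open import Relation.Binary.Definitions using (DecidableEquality; tri<; tri≈; tri>)
open import Relation.Binary.PropositionalEquality as ≡ using (_≡_; _≢_; cong; cong₂; subst)
import Algebra.Properties.Group
open import Defs

private variable
  a b p q r : Level
  A : Set a
  B : Set b

length-filter-partition : {P : Pred A p} (P? : Decidable P) (xs : List A) →
  length (filter P? xs) ℕ.+ length (filter (¬? ∘ P?) xs) ≡ length xs
length-filter-partition P? [] = ≡.refl
length-filter-partition P? (x ∷ xs) with P? x
... | yes _ = cong suc (length-filter-partition P? xs)
... | no _ = ≡.trans (+-suc _ _) (cong suc (length-filter-partition P? xs))

AllPairs-lookup : {R : A → A → Set r} {xs : List A} → AllPairs R xs →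
  (i j : Fin (length xs)) → toℕ i < toℕ j → R (lookup xs i) (lookup xs j)
AllPairs-lookup (h ∷ _) zero (suc j) _ = All.lookup h (∈-lookup j)
AllPairs-lookup (_ ∷ d) (suc i) (suc j) i<j = AllPairs-lookup d i j (s≤s⁻¹ i<j)

Unique-Fin-length≤ : ∀ {n} (xs : List (Fin n)) → Unique xs → length xs ≤ n
Unique-Fin-length≤ {n} xs uniq with ≤-<-connex (length xs) n
... | inj₁ le = le
... | inj₂ gt with i , j , i<j , eq ← Finₚ.pigeonhole gt (lookup xs) = ⊥-elim (AllPairs-lookup uniq i j i<j eq)

map⁺-injectiveOn : {R : Pred A r} (f : A → B) → (∀ {x y} → R x → R y → f x ≡ f y → x ≡ y) →
  ∀ {xs} → Unique xs → All R xs → Unique (map f xs)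
map⁺-injectiveOn f inj [] [] = []
map⁺-injectiveOn {R = R} f inj {x ∷ _} (x∉ ∷ uniq) (rx ∷ rxs) = fresh x∉ rxs ∷ map⁺-injectiveOn f inj uniq rxs
  where
  fresh : ∀ {ys} → All (x ≢_) ys → All R ys → All (f x ≢_) (map f ys)
  fresh [] [] = []
  fresh (x≢y ∷ ns) (ry ∷ rys) = (x≢y ∘ inj rx ry) ∷ fresh ns rys

map-proj₂⁺ : ∀ {x : A} {L : List (A × B)} → Unique L → All ((_≡ x) ∘ proj₁) L → Unique (map proj₂ L)
map-proj₂⁺ uniq keys = map⁺-injectiveOn proj₂ (λ ex ey e → cong₂ _,_ (≡.trans ex (≡.sym ey)) e) uniq keys

Unique-pairs-length≤ : DecidableEquality A → {P : Pred A p} {Q : A → Pred B q} (m n : ℕ) →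
  (∀ xs → Unique xs → All P xs → length xs ≤ m) →
  (∀ x → P x → ∀ ys → Unique ys → All (Q x) ys → length ys ≤ n) →
  ∀ (L : List (A × B)) → Unique L → All (uncurry λ x y → P x × Q x y) L → length L ≤ m ℕ.* n
Unique-pairs-length≤ _≟_ m n keys fibre [] _ _ = z≤n
Unique-pairs-length≤ _≟_ zero n keys fibre ((x , _) ∷ _) _ ((px , _) ∷ _)
  with () ← keys (x ∷ []) ([] ∷ []) (px ∷ [])
Unique-pairs-length≤ {A = A} {B = B} _≟_ {P} {Q} (suc m) n keys fibre L@((x , _) ∷ _) uniq all =
  subst (_≤ suc m ℕ.* n) (length-filter-partition at-x? L) (+-mono-≤ same-key other-keys)
  where
  at-x? : Decidable (λ (z : A × B) → proj₁ z ≡ x)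
  at-x? z = proj₁ z ≟ x
  same-key : length (filter at-x? L) ≤ n
  same-key = subst (_≤ n) (length-map proj₂ (filter at-x? L))
    (fibre x (proj₁ (All.head all)) (map proj₂ (filter at-x? L)) (map-proj₂⁺ (Unique.filter⁺ at-x? uniq) (all-filter at-x? L))
      (All.map⁺ (All.map (λ { (≡.refl , (_ , qz)) → qz }) (All.zip (all-filter at-x? L , All.filter⁺ at-x? all)))))
  other-keys : length (filter (¬? ∘ at-x?) L) ≤ m ℕ.* n
  other-keys = Unique-pairs-length≤ _≟_ {P = λ z → P z × z ≢ x} m n
    (λ xs uxs axs → s≤s⁻¹ (keys (x ∷ xs) (All.map (λ (_ , z≢x) → z≢x ∘ ≡.sym) axs ∷ uxs)
                                         (proj₁ (All.head all) ∷ All.map proj₁ axs)))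
    (λ z → fibre z ∘ proj₁) _ (Unique.filter⁺ (¬? ∘ at-x?) uniq)
    (All.map (λ ((pz , qz) , z≢x) → (pz , z≢x) , qz) (All.zip (All.filter⁺ (¬? ∘ at-x?) all , all-filter (¬? ∘ at-x?) L)))

Unique-Fin²-length≤ : ∀ {n} (L : List (Fin n × Fin n)) → Unique L → length L ≤ n ℕ.* n
Unique-Fin²-length≤ {n} L uniq = Unique-pairs-length≤ Finₚ._≟_ {P = U} {Q = λ _ → U} n n
  (λ xs u _ → Unique-Fin-length≤ xs u) (λ _ _ ys u _ → Unique-Fin-length≤ ys u)
  L uniq (All.universal (λ _ → tt , tt) L)

≤-stable : ∀ {m n} → ¬ ¬ (m ≤ n) → m ≤ n
≤-stable {m} {n} = decidable-stable (m ≤? n)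

¬¬-∀-Fin : ∀ n {P : Pred (Fin n) p} → (∀ i → ¬ ¬ P i) → ¬ ¬ (∀ i → P i)
¬¬-∀-Fin zero _ k = k λ ()
¬¬-∀-Fin (suc n) ¬¬P k = ¬¬P zero λ P0 → ¬¬-∀-Fin n (¬¬P ∘ suc) λ Ps → k λ { zero → P0 ; (suc i) → Ps i }

module _ {A : Set a} {P : Pred A p} {f : ∀ {x} → P x → B} where

  length-reduce : ∀ {xs} (pxs : All P xs) → length (All.reduce f pxs) ≡ length xs
  length-reduce [] = ≡.refl
  length-reduce (_ ∷ pxs) = cong suc (length-reduce pxs)

  All-reduce : {Q : Pred B q} → (∀ {x} (px : P x) → Q (f px)) → ∀ {xs} (pxs : All P xs) → All Q (All.reduce f pxs)
  All-reduce Qf [] = []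
  All-reduce Qf (px ∷ pxs) = Qf px ∷ All-reduce Qf pxs

  Unique-reduce : {R : A → A → Set r} → (∀ {x y} (px : P x) (py : P y) → R x y → f px ≢ f py) →
    ∀ {xs} → AllPairs R xs → (pxs : All P xs) → Unique (All.reduce f pxs)
  Unique-reduce inj [] [] = []
  Unique-reduce {R = R} inj {x ∷ _} (x#xs ∷ xs#) (px ∷ pxs) = fresh x#xs pxs ∷ Unique-reduce inj xs# pxs
    where
    fresh : ∀ {ys} → All (R x) ys → (pys : All P ys) → All (f px ≢_) (All.reduce f pys)
    fresh [] [] = []
    fresh (x#y ∷ x#ys) (py ∷ pys) = inj px py x#y ∷ fresh x#ys pys

module AffineGeometry {c ℓ} (F : Field c ℓ) where
  open Field F hiding (zero)
  open import Relation.Binary.Reasoning.Setoid setoid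
  open import Algebra.Solver.Ring.NaturalCoefficients.Default commutativeSemiring
    using (solve; _:=_; _:+_; _:*_)
  open import Algebra.Properties.Ring ring using (-‿distribˡ-*; -‿distribʳ-*)
  private module + = Algebra.Properties.Group +-group

  ∑ : ∀ {k} → (Fin k → Carrier) → Carrier
  ∑ = sumF F

  infix 7 _·_
  _·_ : ∀ {d} → Point F d → Point F d → Carrier
  _·_ = dot F

  ∑-cong : ∀ {k} {f g : Fin k → Carrier} → (∀ i → f i ≈ g i) → ∑ f ≈ ∑ g
  ∑-cong {zero} _ = refl
  ∑-cong {suc k} f≈g = +-cong (f≈g zero) (∑-cong (f≈g ∘ suc))

  ∑-zero : ∀ {k} {f : Fin k → Carrier} → (∀ i → f i ≈ 0#) → ∑ f ≈ 0#
  ∑-zero {zero} _ = refl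
  ∑-zero {suc k} f≈0 = trans (+-cong (f≈0 zero) (∑-zero (f≈0 ∘ suc))) (+-identityˡ 0#)

  ∑-+ : ∀ {k} (f g : Fin k → Carrier) → ∑ (λ i → f i + g i) ≈ ∑ f + ∑ g
  ∑-+ {zero} f g = sym (+-identityˡ 0#)
  ∑-+ {suc k} f g = trans (+-cong refl (∑-+ (f ∘ suc) (g ∘ suc)))
    (solve 4 (λ a b c d → ((a :+ b) :+ (c :+ d)) := ((a :+ c) :+ (b :+ d))) refl _ _ _ _)

  ∑-*ˡ : ∀ {k} (a : Carrier) (f : Fin k → Carrier) → ∑ (λ i → a * f i) ≈ a * ∑ f
  ∑-*ˡ {zero} a f = sym (zeroʳ a)
  ∑-*ˡ {suc k} a f = trans (+-cong refl (∑-*ˡ a (f ∘ suc))) (sym (distribˡ a _ _))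

  ∑-swap : ∀ {k m} (f : Fin k → Fin m → Carrier) → ∑ (λ i → ∑ (f i)) ≈ ∑ (λ j → ∑ (λ i → f i j))
  ∑-swap {zero} {m} f = sym (∑-zero {m} (λ _ → refl))
  ∑-swap {suc k} f = trans (+-cong refl (∑-swap (f ∘ suc))) (sym (∑-+ (f zero) _))

  δ : ∀ {m} → Fin m → Fin m → Carrier
  δ zero    zero    = 1#
  δ zero    (suc _) = 0#
  δ (suc _) zero    = 0#
  δ (suc i) (suc j) = δ i j

  δ-sym : ∀ {m} (i j : Fin m) → δ i j ≡ δ j i
  δ-sym zero    zero    = ≡.refl
  δ-sym zero    (suc _) = ≡.refl
  δ-sym (suc _) zero    = ≡.refl
  δ-sym (suc i) (suc j) = δ-sym i j

  δ-↑ʳ : ∀ {m} n (i j : Fin m) → δ (n ↑ʳ i) (n ↑ʳ j) ≡ δ i j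
  δ-↑ʳ zero    i j = ≡.refl
  δ-↑ʳ (suc n) i j = δ-↑ʳ n i j

  ∑-δ : ∀ {m} (f : Fin m → Carrier) (j : Fin m) → ∑ (λ i → f i * δ i j) ≈ f j
  ∑-δ f zero    = trans (+-cong (*-identityʳ _) (∑-zero (λ i → zeroʳ (f (suc i))))) (+-identityʳ _)
  ∑-δ f (suc j) = trans (+-cong (zeroʳ _) (∑-δ (f ∘ suc) j)) (+-identityˡ _)

  ∑-δˡ : ∀ {m} (f : Fin m → Carrier) (j : Fin m) → ∑ (λ i → f i * δ j i) ≈ f j
  ∑-δˡ f j = trans (∑-cong (λ i → *-cong refl (reflexive (δ-sym j i)))) (∑-δ f j)

  ·-comm : ∀ {d} (p q : Point F d) → p · q ≈ q · p
  ·-comm p q = ∑-cong (λ i → *-comm (p i) (q i))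

  ·-cong : ∀ {d} {p p' q q' : Point F d} → _≈ᵖ_ F p p' → _≈ᵖ_ F q q' → p · q ≈ p' · q'
  ·-cong p≈p' q≈q' = ∑-cong (λ i → *-cong (p≈p' i) (q≈q' i))

  ·-+ˡ : ∀ {d} (x y w : Point F d) → (λ i → x i + y i) · w ≈ x · w + y · w
  ·-+ˡ x y w = trans (∑-cong (λ i → distribʳ (w i) (x i) (y i))) (∑-+ (λ i → x i * w i) (λ i → y i * w i))

  ·-*ˡ : ∀ {d} (κ : Carrier) (x w : Point F d) → (λ i → κ * x i) · w ≈ κ * (x · w)
  ·-*ˡ κ x w = trans (∑-cong (λ i → *-assoc κ (x i) (w i))) (∑-*ˡ κ (λ i → x i * w i))

  ·-lincombˡ : ∀ {d k} (λs : Fin k → Carrier) (v : Fin k → Point F d) (w : Point F d) →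
    lincomb F λs v · w ≈ ∑ (λ l → λs l * (v l · w))
  ·-lincombˡ λs v w = begin
    ∑ (λ i → ∑ (λ l → λs l * v l i) * w i)
      ≈⟨ ∑-cong (λ i → trans (*-comm _ _) (sym (∑-*ˡ (w i) (λ l → λs l * v l i)))) ⟩
    ∑ (λ i → ∑ (λ l → w i * (λs l * v l i)))
      ≈⟨ ∑-swap (λ i l → w i * (λs l * v l i)) ⟩
    ∑ (λ l → ∑ (λ i → w i * (λs l * v l i)))
      ≈⟨ ∑-cong (λ l → trans (∑-cong (λ i → reorder (w i) (λs l) (v l i))) (∑-*ˡ (λs l) (λ i → v l i * w i))) ⟩
    ∑ (λ l → λs l * (v l · w))
      ∎
    where
    reorder : ∀ a b x → a * (b * x) ≈ b * (x * a)
    reorder = solve 3 (λ a b x → (a :* (b :* x)) := (b :* (x :* a))) refl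

  ·-nonzeroˡ : ∀ {d} {p q : Point F d} {γ} → p · q ≈ γ → ¬ γ ≈ 0# → ¬ (∀ i → p i ≈ 0#)
  ·-nonzeroˡ {q = q} p·q≈γ γ≉0 p≈0 = γ≉0 (trans (sym p·q≈γ) (∑-zero (λ i → trans (*-cong (p≈0 i) refl) (zeroˡ (q i)))))

  lincomb-congˡ : ∀ {d k} {λs μs : Fin k → Carrier} (v : Fin k → Point F d) →
    (∀ l → λs l ≈ μs l) → _≈ᵖ_ F (lincomb F λs v) (lincomb F μs v)
  lincomb-congˡ v λs≈μs i = ∑-cong (λ l → *-cong (λs≈μs l) refl)

  lincomb-+ˡ : ∀ {d k} (λs μs : Fin k → Carrier) (v : Fin k → Point F d) →
    _≈ᵖ_ F (lincomb F (λ l → λs l + μs l) v) (λ i → lincomb F λs v i + lincomb F μs v i)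
  lincomb-+ˡ λs μs v i = trans (∑-cong (λ l → distribʳ (v l i) (λs l) (μs l))) (∑-+ (λ l → λs l * v l i) (λ l → μs l * v l i))

  lincomb-lincomb : ∀ {d k m} (μs : Fin m → Carrier) (w : Fin m → Fin k → Carrier) (v : Fin k → Point F d) →
    _≈ᵖ_ F (lincomb F μs (λ q → lincomb F (w q) v)) (lincomb F (lincomb F μs w) v)
  lincomb-lincomb μs w v i = begin
    ∑ (λ q → μs q * ∑ (λ l → w q l * v l i))
      ≈⟨ ∑-cong (λ q → sym (∑-*ˡ (μs q) (λ l → w q l * v l i))) ⟩
    ∑ (λ q → ∑ (λ l → μs q * (w q l * v l i)))
      ≈⟨ ∑-swap (λ q l → μs q * (w q l * v l i)) ⟩
    ∑ (λ l → ∑ (λ q → μs q * (w q l * v l i)))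
      ≈⟨ ∑-cong (λ l → trans (∑-cong (λ q → reorder (μs q) (w q l) (v l i))) (∑-*ˡ (v l i) (λ q → μs q * w q l))) ⟩
    ∑ (λ l → v l i * ∑ (λ q → μs q * w q l))
      ≈⟨ ∑-cong (λ l → *-comm (v l i) (∑ (λ q → μs q * w q l))) ⟩
    ∑ (λ l → ∑ (λ q → μs q * w q l) * v l i)
      ∎
    where
    reorder : ∀ a b x → a * (b * x) ≈ x * (a * b)
    reorder = solve 3 (λ a b x → (a :* (b :* x)) := (x :* (a :* b))) refl

  ∑-headless : ∀ {k} (f : Fin (suc k) → Carrier) → f zero ≈ 0# → ∑ f ≈ ∑ (f ∘ suc)
  ∑-headless f f₀≈0 = trans (+-cong f₀≈0 refl) (+-identityˡ _)

  ∑-tailless : ∀ {k} (f : Fin (suc k) → Carrier) → (∀ i → f (suc i) ≈ 0#) → ∑ f ≈ f zero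
  ∑-tailless f fₛ≈0 = trans (+-cong refl (∑-zero fₛ≈0)) (+-identityʳ _)

  coordinatePlane : ∀ m k → Plane F (m ℕ.+ k) k
  coordinatePlane m k = record { base = λ _ → 0# ; dir = λ l → δ (m ↑ʳ l) ; indep = indep }
    where
    indep : LinIndep F (λ l → δ (m ↑ʳ l))
    indep λs comb≈0 j = begin
      λs j                           ≈⟨ sym (∑-δ λs j) ⟩
      ∑ (λ l → λs l * δ l j)         ≈⟨ ∑-cong (λ l → *-cong refl (reflexive (≡.sym (δ-↑ʳ m l j)))) ⟩
      lincomb F λs (λ l → δ (m ↑ʳ l)) (m ↑ʳ j) ≈⟨ comb≈0 (m ↑ʳ j) ⟩
      0#                             ∎

  record HyperplaneChart {m} (p : Point F (suc m)) (α : Carrier) : Set (c ⊔ ℓ) where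
    field
      plane : Plane F (suc m) m
    open Plane plane public
    field
      covers   : ∀ x → p · x ≈ α → _∈Plane_ F x plane
      p·base   : p · base ≈ α
      p·dir    : ∀ l → p · dir l ≈ 0#
      ⊥dir⇒∝p : ∀ z → (∀ l → z · dir l ≈ 0#) → ∃ λ κ → _≈ᵖ_ F z (λ i → κ * p i)

  -- Solve p · x = α for x₀ = π (α - p₁x₁ - … - pₘxₘ), where π = p₀⁻¹, keeping x₁, …, xₘ as coordinates.
  module _ {m} (p : Point F (suc m)) (α : Carrier) (p₀≉0 : ¬ p zero ≈ 0#) where
    private
      π : Carrier
      π = proj₁ (inverse (p zero) p₀≉0)
      p₀π≈1 : p zero * π ≈ 1#
      p₀π≈1 = proj₂ (inverse (p zero) p₀≉0)

      base : Point F (suc m)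
      base zero    = α * π
      base (suc _) = 0#

      dir : Fin m → Point F (suc m)
      dir l zero    = - (p (suc l) * π)
      dir l (suc j) = δ l j

      indep : LinIndep F dir
      indep λs comb≈0 j = trans (sym (∑-δ λs j)) (comb≈0 (suc j))

      covers : ∀ x → p · x ≈ α → _∈Plane_ F x (record { base = base ; dir = dir ; indep = indep })
      covers x p·x≈α = x ∘ suc , λ { zero → sym coord₀ ; (suc j) → sym (trans (+-identityˡ _) (∑-δ (x ∘ suc) j)) }
        where
        T : Carrier
        T = ∑ (λ l → p (suc l) * x (suc l))
        απ≈x₀+πT : α * π ≈ x zero + π * T
        απ≈x₀+πT = begin
          α * π                          ≈⟨ *-cong (sym p·x≈α) refl ⟩
          (p zero * x zero + T) * π      ≈⟨ solve 4 (λ a b c d → ((a :* b :+ c) :* d) := ((a :* d) :* b :+ d :* c)) refl _ _ _ _ ⟩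
          (p zero * π) * x zero + π * T  ≈⟨ +-cong (trans (*-cong p₀π≈1 refl) (*-identityˡ _)) refl ⟩
          x zero + π * T                 ∎
        coord₀ : α * π + ∑ (λ l → x (suc l) * - (p (suc l) * π)) ≈ x zero
        coord₀ = begin
          α * π + ∑ (λ l → x (suc l) * - (p (suc l) * π))
            ≈⟨ +-cong απ≈x₀+πT (∑-cong {m} (λ l → x*-[pπ]≈-π*[px] (x (suc l)) (p (suc l)))) ⟩
          (x zero + π * T) + ∑ (λ l → - π * (p (suc l) * x (suc l)))
            ≈⟨ +-cong refl (trans (∑-*ˡ (- π) (λ l → p (suc l) * x (suc l))) (sym (-‿distribˡ-* π T))) ⟩
          (x zero + π * T) + - (π * T)
            ≈⟨ +.//-rightDividesʳ (π * T) (x zero) ⟩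
          x zero
            ∎
          where
          x*-[pπ]≈-π*[px] : ∀ a b → a * - (b * π) ≈ - π * (b * a)
          x*-[pπ]≈-π*[px] a b = trans (sym (-‿distribʳ-* a (b * π)))
            (trans (-‿cong (solve 3 (λ a b c → (a :* (b :* c)) := (c :* (b :* a))) refl a b π)) (-‿distribˡ-* π (b * a)))

      p·base : p · base ≈ α
      p·base = begin
        p · base             ≈⟨ ∑-tailless (λ i → p i * base i) (λ i → zeroʳ (p (suc i))) ⟩
        p zero * (α * π)     ≈⟨ solve 3 (λ a b c → (a :* (b :* c)) := (b :* (a :* c))) refl _ _ _ ⟩
        α * (p zero * π)     ≈⟨ trans (*-cong refl p₀π≈1) (*-identityʳ α) ⟩
        α                    ∎

      b*-[aπ]≈-[bπ*a] : ∀ {a} (b : Carrier) → b * - (a * π) ≈ - ((b * π) * a)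
      b*-[aπ]≈-[bπ*a] {a} b = trans (sym (-‿distribʳ-* b (a * π)))
        (-‿cong (solve 3 (λ a b c → (b :* (a :* c)) := ((b :* c) :* a)) refl a b π))

      p·dir : ∀ l → p · dir l ≈ 0#
      p·dir l = begin
        p zero * - (p (suc l) * π) + ∑ (λ j → p (suc j) * δ l j) ≈⟨ +-cong (b*-[aπ]≈-[bπ*a] (p zero)) (∑-δˡ (p ∘ suc) l) ⟩
        - ((p zero * π) * p (suc l)) + p (suc l)                 ≈⟨ +-cong (-‿cong (trans (*-cong p₀π≈1 refl) (*-identityˡ _))) refl ⟩
        - p (suc l) + p (suc l)                                  ≈⟨ -‿inverseˡ _ ⟩
        0#                                                       ∎

      ⊥dir⇒∝p : ∀ z → (∀ l → z · dir l ≈ 0#) → ∃ λ κ → _≈ᵖ_ F z (λ i → κ * p i)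
      ⊥dir⇒∝p z z⊥dir = z zero * π , λ { zero → coord₀ ; (suc l) → coordₛ l }
        where
        coord₀ : z zero ≈ (z zero * π) * p zero
        coord₀ = sym (trans (solve 3 (λ a b c → ((a :* b) :* c) := (a :* (c :* b))) refl _ _ _)
                            (trans (*-cong refl p₀π≈1) (*-identityʳ _)))
        coordₛ : ∀ l → z (suc l) ≈ (z zero * π) * p (suc l)
        coordₛ l = trans (+.inverseʳ-unique _ _ -[κp]+z≈0) (+.⁻¹-involutive _)
          where
          -[κp]+z≈0 : - ((z zero * π) * p (suc l)) + z (suc l) ≈ 0#
          -[κp]+z≈0 = trans (+-cong (sym (b*-[aπ]≈-[bπ*a] (z zero))) (sym (∑-δˡ (z ∘ suc) l))) (z⊥dir l)

    chart-pivot : HyperplaneChart p α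
    chart-pivot = record
      { plane = record { base = base ; dir = dir ; indep = indep }
      ; covers = covers ; p·base = p·base ; p·dir = p·dir ; ⊥dir⇒∝p = ⊥dir⇒∝p }

  -- When p₀ = 0 the first coordinate is free: prepend it, as direction e₀, to a chart of the tail of p.
  module _ {m} (p : Point F (suc (suc m))) (α : Carrier) (p₀≈0 : p zero ≈ 0#) (H : HyperplaneChart (p ∘ suc) α) where
    private
      module H = HyperplaneChart H

      base : Point F (suc (suc m))
      base zero    = 0#
      base (suc j) = H.base j

      dir : Fin (suc m) → Point F (suc (suc m))
      dir zero    zero    = 1#
      dir zero    (suc _) = 0#
      dir (suc l) zero    = 0#
      dir (suc l) (suc j) = H.dir l j

      indep : LinIndep F dir
      indep λs comb≈0 zero    =
        trans (sym (trans (∑-tailless (λ l → λs l * dir l zero) (λ l → zeroʳ (λs (suc l)))) (*-identityʳ _))) (comb≈0 zero)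
      indep λs comb≈0 (suc l) =
        H.indep (λs ∘ suc) (λ j → trans (sym (∑-headless (λ l → λs l * dir l (suc j)) (zeroʳ (λs zero)))) (comb≈0 (suc j))) l

      covers : ∀ x → p · x ≈ α → _∈Plane_ F x (record { base = base ; dir = dir ; indep = indep })
      covers x p·x≈α = μs , λ { zero → coord₀ ; (suc j) → coordₛ j }
        where
        tail-on : (p ∘ suc) · (x ∘ suc) ≈ α
        tail-on = trans (sym (∑-headless (λ i → p i * x i) (trans (*-cong p₀≈0 refl) (zeroˡ _)))) p·x≈α
        μ : Fin m → Carrier
        μ = proj₁ (H.covers (x ∘ suc) tail-on)
        μs : Fin (suc m) → Carrier
        μs zero    = x zero
        μs (suc l) = μ l
        coord₀ : x zero ≈ 0# + lincomb F μs dir zero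
        coord₀ = sym (trans (+-identityˡ _) (trans (∑-tailless (λ l → μs l * dir l zero) (λ l → zeroʳ (μ l))) (*-identityʳ _)))
        coordₛ : ∀ j → x (suc j) ≈ H.base j + lincomb F μs dir (suc j)
        coordₛ j = trans (proj₂ (H.covers (x ∘ suc) tail-on) j)
                         (+-cong refl (sym (∑-headless (λ l → μs l * dir l (suc j)) (zeroʳ (x zero)))))

      ⊥dir⇒∝p : ∀ z → (∀ l → z · dir l ≈ 0#) → ∃ λ κ → _≈ᵖ_ F z (λ i → κ * p i)
      ⊥dir⇒∝p z z⊥dir = κ , λ { zero    → trans z₀≈0 (sym (trans (*-cong refl p₀≈0) (zeroʳ κ)))
                                ; (suc j) → proj₂ tail∝ j }
        where
        tail∝ : ∃ λ κ → _≈ᵖ_ F (z ∘ suc) (λ i → κ * p (suc i))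
        tail∝ = H.⊥dir⇒∝p (z ∘ suc) (λ l → trans (sym (∑-headless (λ i → z i * dir (suc l) i) (zeroʳ (z zero)))) (z⊥dir (suc l)))
        κ : Carrier
        κ = proj₁ tail∝
        z₀≈0 : z zero ≈ 0#
        z₀≈0 = trans (sym (trans (∑-tailless (λ i → z i * dir zero i) (λ l → zeroʳ (z (suc l)))) (*-identityʳ _))) (z⊥dir zero)

    chart-0∷ : HyperplaneChart p α
    chart-0∷ = record
      { plane   = record { base = base ; dir = dir ; indep = indep }
      ; covers  = covers
      ; p·base  = trans (∑-headless (λ i → p i * base i) (zeroʳ (p zero))) H.p·base
      ; p·dir   = λ { zero    → trans (∑-tailless (λ i → p i * dir zero i) (λ l → zeroʳ (p (suc l))))
                                      (trans (*-identityʳ _) p₀≈0)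
                    ; (suc l) → trans (∑-headless (λ i → p i * dir (suc l) i) (zeroʳ (p zero))) (H.p·dir l) }
      ; ⊥dir⇒∝p = ⊥dir⇒∝p }

  ¬¬-chart : ∀ {m} (p : Point F (suc m)) (α : Carrier) → ¬ (∀ i → p i ≈ 0#) → ¬ ¬ HyperplaneChart p α
  ¬¬-chart {zero} p α p≉0 no-chart = ¬¬-excluded-middle λ
    { (no p₀≉0)  → no-chart (chart-pivot p α p₀≉0)
    ; (yes p₀≈0) → p≉0 λ { zero → p₀≈0 } }
  ¬¬-chart {suc m} p α p≉0 no-chart = ¬¬-excluded-middle λ
    { (no p₀≉0)  → no-chart (chart-pivot p α p₀≉0)
    ; (yes p₀≈0) → ¬¬-chart (p ∘ suc) α (λ tail≈0 → p≉0 λ { zero → p₀≈0 ; (suc i) → tail≈0 i })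
                              (no-chart ∘ chart-0∷ p α p₀≈0) }

  ·-affineˡ : ∀ {d k} (b : Point F d) (λs : Fin k → Carrier) (v : Fin k → Point F d) (w : Point F d) →
    (λ i → b i + lincomb F λs v i) · w ≈ b · w + ∑ (λ l → λs l * (v l · w))
  ·-affineˡ b λs v w = trans (·-+ˡ b (lincomb F λs v) w) (+-cong refl (·-lincombˡ λs v w))

  subplane : ∀ {d k j} → Plane F d k → Plane F k j → Plane F d j
  subplane Π Π′ = record
    { base  = λ i → Π.base i + lincomb F Π′.base Π.dir i
    ; dir   = λ l → lincomb F (Π′.dir l) Π.dir
    ; indep = λ μs comb≈0 → Π′.indep μs (Π.indep (lincomb F μs Π′.dir)
                (λ i → trans (sym (lincomb-lincomb μs Π′.dir Π.dir i)) (comb≈0 i))) }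
    where
    module Π = Plane Π
    module Π′ = Plane Π′

  ∈-subplane : ∀ {d k j} (Π : Plane F d k) (Π′ : Plane F k j) {x : Point F d} (λs : Fin k → Carrier) →
    _≈ᵖ_ F x (λ i → Plane.base Π i + lincomb F λs (Plane.dir Π) i) →
    _∈Plane_ F λs Π′ → _∈Plane_ F x (subplane Π Π′)
  ∈-subplane Π Π′ {x} λs x≈ (μs , λs≈) = μs , λ i → begin
    x i
      ≈⟨ x≈ i ⟩
    Π.base i + lincomb F λs Π.dir i
      ≈⟨ +-cong refl (lincomb-congˡ Π.dir λs≈ i) ⟩
    Π.base i + lincomb F (λ l → Π′.base l + lincomb F μs Π′.dir l) Π.dir i
      ≈⟨ +-cong refl (lincomb-+ˡ Π′.base (lincomb F μs Π′.dir) Π.dir i) ⟩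
    Π.base i + (lincomb F Π′.base Π.dir i + lincomb F (lincomb F μs Π′.dir) Π.dir i)
      ≈⟨ sym (+-assoc _ _ _) ⟩
    (Π.base i + lincomb F Π′.base Π.dir i) + lincomb F (lincomb F μs Π′.dir) Π.dir i
      ≈⟨ +-cong refl (sym (lincomb-lincomb μs Π′.dir Π.dir i)) ⟩
    (Π.base i + lincomb F Π′.base Π.dir i) + lincomb F μs (λ l → lincomb F (Π′.dir l) Π.dir) i
      ∎
    where
    module Π = Plane Π
    module Π′ = Plane Π′

  ·-nonzeroʳ : ∀ {d} {p q : Point F d} {γ} → p · q ≈ γ → ¬ γ ≈ 0# → ¬ (∀ i → q i ≈ 0#)
  ·-nonzeroʳ {p = p} {q} p·q≈γ = ·-nonzeroˡ {p = q} {q = p} (trans (·-comm q p) p·q≈γ)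

  -- On a chart of q · x = α, the equation r · x = β reads u · λ = β − base · r with u_l = r · dir_l:
  -- a hyperplane of the coordinate space when u ≠ 0, while u = 0 makes r orthogonal to all
  -- directions of the chart, hence a multiple of q.
  module _ {m} {q : Point F (suc (suc m))} {α : Carrier} (H : HyperplaneChart q α) (r : Point F (suc (suc m))) (β : Carrier) where
    private module H = HyperplaneChart H

    on-chart : ∀ x → x · q ≈ α → ∃ λ λs → _≈ᵖ_ F x (λ i → H.base i + lincomb F λs H.dir i)
    on-chart x x·q≈α = H.covers x (trans (·-comm q x) x·q≈α)

    ·r-on-chart : ∀ x λs → _≈ᵖ_ F x (λ i → H.base i + lincomb F λs H.dir i) →
      x · r ≈ H.base · r + ∑ (λ l → λs l * (H.dir l · r))
    ·r-on-chart x λs x≈ = trans (·-cong {p = x} {q = r} x≈ (λ _ → refl)) (·-affineˡ H.base λs H.dir r)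

    ⊥dir⇒∝ : (∀ l → r · H.dir l ≈ 0#) → ∀ x → x · q ≈ α → x · r ≈ β →
      ∃ λ κ → κ * α ≈ β × _≈ᵖ_ F r (λ i → κ * q i)
    ⊥dir⇒∝ r⊥dir x x·q≈α x·r≈β = κ , κα≈β , r≈κq
      where
      κ : Carrier
      κ = proj₁ (H.⊥dir⇒∝p r r⊥dir)
      r≈κq : _≈ᵖ_ F r (λ i → κ * q i)
      r≈κq = proj₂ (H.⊥dir⇒∝p r r⊥dir)
      λs : Fin (suc m) → Carrier
      λs = proj₁ (on-chart x x·q≈α)
      base·r≈β : H.base · r ≈ β
      base·r≈β = begin
        H.base · r                                   ≈⟨ sym (+-identityʳ _) ⟩
        H.base · r + 0#                              ≈⟨ +-cong refl (sym (∑-zero {f = λ l → λs l * (H.dir l · r)} λs·u≈0)) ⟩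
        H.base · r + ∑ (λ l → λs l * (H.dir l · r))  ≈⟨ sym (·r-on-chart x λs (proj₂ (on-chart x x·q≈α))) ⟩
        x · r                                        ≈⟨ x·r≈β ⟩
        β                                            ∎
        where
        λs·u≈0 : ∀ l → λs l * (H.dir l · r) ≈ 0#
        λs·u≈0 l = trans (*-cong refl (trans (·-comm (H.dir l) r) (r⊥dir l))) (zeroʳ _)
      κα≈β : κ * α ≈ β
      κα≈β = begin
        κ * α                       ≈⟨ *-cong refl (sym H.p·base) ⟩
        κ * (q · H.base)            ≈⟨ sym (·-*ˡ κ q H.base) ⟩
        (λ i → κ * q i) · H.base    ≈⟨ ·-cong {p = λ i → κ * q i} {q = H.base} (λ i → sym (r≈κq i)) (λ _ → refl) ⟩
        r · H.base                  ≈⟨ trans (·-comm r H.base) base·r≈β ⟩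
        β                           ∎

    module _ (H′ : HyperplaneChart (λ l → r · H.dir l) (- (H.base · r) + β)) where
      private module H′ = HyperplaneChart H′

      ∈-subplane-charts : ∀ x → x · q ≈ α → x · r ≈ β → _∈Plane_ F x (subplane H.plane H′.plane)
      ∈-subplane-charts x x·q≈α x·r≈β = ∈-subplane H.plane H′.plane λs x≈ (H′.covers λs u·λs≈c)
        where
        λs : Fin (suc m) → Carrier
        λs = proj₁ (on-chart x x·q≈α)
        x≈ : _≈ᵖ_ F x (λ i → H.base i + lincomb F λs H.dir i)
        x≈ = proj₂ (on-chart x x·q≈α)
        u·λs≈c : (λ l → r · H.dir l) · λs ≈ - (H.base · r) + β
        u·λs≈c = begin
          ∑ (λ l → (r · H.dir l) * λs l)
            ≈⟨ ∑-cong {suc m} (λ l → trans (*-comm (r · H.dir l) (λs l)) (*-cong refl (·-comm r (H.dir l)))) ⟩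
          ∑ (λ l → λs l * (H.dir l · r))
            ≈⟨ sym (+.\\-leftDividesʳ (H.base · r) _) ⟩
          - (H.base · r) + (H.base · r + ∑ (λ l → λs l * (H.dir l · r)))
            ≈⟨ +-cong refl (trans (sym (·r-on-chart x λs x≈)) x·r≈β) ⟩
          - (H.base · r) + β
            ∎

  ¬¬-codim2-plane : ∀ {m} {q r : Point F (suc (suc m))} {α β} → ¬ α ≈ 0# → ∀ x₀ → x₀ · q ≈ α → x₀ · r ≈ β →
    ¬ (∃ λ κ → κ * α ≈ β × _≈ᵖ_ F r (λ i → κ * q i)) →
    ¬ ¬ (Σ (Plane F (suc (suc m)) m) λ Π → ∀ x → x · q ≈ α → x · r ≈ β → _∈Plane_ F x Π)
  ¬¬-codim2-plane {q = q} {r} {α = α} {β} α≉0 x₀ x₀·q≈α x₀·r≈β r≉κq no-plane =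
    ¬¬-chart q α (·-nonzeroʳ {p = x₀} {q = q} x₀·q≈α α≉0) λ H →
    ¬¬-excluded-middle λ
      { (yes r⊥dir) → r≉κq (⊥dir⇒∝ H r β r⊥dir x₀ x₀·q≈α x₀·r≈β)
      ; (no r⊥̸dir) → ¬¬-chart (λ l → r · HyperplaneChart.dir H l) (- (HyperplaneChart.base H · r) + β) r⊥̸dir λ H′ →
          no-plane (subplane (HyperplaneChart.plane H) (HyperplaneChart.plane H′) , ∈-subplane-charts H r β H′) }

  *-cancelʳ-≉0 : ∀ {α} → ¬ α ≈ 0# → ∀ x y → x * α ≈ y * α → x ≈ y
  *-cancelʳ-≉0 {α} α≉0 x y xα≈yα = begin
    x               ≈⟨ times-one x ⟩
    (x * α) * α⁻¹   ≈⟨ *-cong xα≈yα refl ⟩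
    (y * α) * α⁻¹   ≈⟨ sym (times-one y) ⟩
    y               ∎
    where
    α⁻¹ : Carrier
    α⁻¹ = proj₁ (inverse α α≉0)
    times-one : ∀ z → z ≈ (z * α) * α⁻¹
    times-one z = sym (trans (*-assoc z α α⁻¹) (trans (*-cong refl (proj₂ (inverse α α≉0))) (*-identityʳ z)))

module Counting {c ℓ} (F : Field c ℓ) {e : ℕ} (P : List (Point F (suc (suc e)))) (P-distinct : DistinctPts F P)
                (α β : Field.Carrier F) where
  open Field F using (Carrier; _≈_; 0#; refl; sym; trans; *-cong; setoid) renaming (_*_ to _*ᶠ_)
  open AffineGeometry F
  open import Relation.Binary.Reasoning.Setoid setoid

  N : ℕ
  N = length P

  Q : Fin N → Point F (suc (suc e))
  Q = lookup P

  Q-injective : ∀ {i j} → _≈ᵖ_ F (Q i) (Q j) → i ≡ j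
  Q-injective {i} {j} Qi≈Qj with Finₚ.<-cmp i j
  ... | tri< i<j _ _ = ⊥-elim (AllPairs-lookup P-distinct i j i<j Qi≈Qj)
  ... | tri≈ _ i≡j _ = i≡j
  ... | tri> _ _ j<i = ⊥-elim (AllPairs-lookup P-distinct j i j<i (λ a → sym (Qi≈Qj a)))

  onPlane-length≤ : ∀ {k u} → FewerThanOnPlanes F P k u → (Π : Plane F (suc (suc e)) k) (js : List (Fin N)) →
    Unique js → All (λ j → _∈Plane_ F (Q j) Π) js → length js ≤ pred u
  onPlane-length≤ fewer Π js uniq on = <⇒≤pred (subst (_< _) (length-map Q js)
    (fewer Π (map Q js) (AllPairs.map⁺ (AllPairs.map (λ i≢j → i≢j ∘ Q-injective) uniq))
      (All.map⁺ (All.map (λ {j} Qj∈Π → Membershipₛ.∈-lookup (≋-setoid setoid (suc (suc e))) P j , Qj∈Π) on))))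

  -- Positions in P; unlike points, they have decidable equality, which the counting needs.
  Idx : Set
  Idx = Fin N × Fin N × Fin N

  Good : Idx → Set ℓ
  Good (i , j , k) = Q i · Q j ≈ α × Q i · Q k ≈ β

  CardΠ≤-fromIndices : ∀ {m} → (∀ I → Unique I → All Good I → length I ≤ m) → CardΠ≤ F P α β m
  CardΠ≤-fromIndices bound L L-distinct L∈Π =
    subst (_≤ _) (length-reduce L∈Π) (bound _ (Unique-reduce distinct L-distinct L∈Π) (All-reduce good L∈Π))
    where
    indices : ∀ {t} → InΠ F P α β t → Idx
    indices (p∈ , q∈ , r∈ , _) = index p∈ , index q∈ , index r∈

    good : ∀ {t} (t∈Π : InΠ F P α β t) → Good (indices t∈Π)
    good (p∈ , q∈ , r∈ , p·q≈α , p·r≈β) =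
      trans (sym (·-cong (lookup-index p∈) (lookup-index q∈))) p·q≈α ,
      trans (sym (·-cong (lookup-index p∈) (lookup-index r∈))) p·r≈β

    same-index : ∀ {x y} (x∈ : _∈Set_ F x P) (y∈ : _∈Set_ F y P) → index x∈ ≡ index y∈ → _≈ᵖ_ F x y
    same-index x∈ y∈ eq a = trans (subst (λ i → _ ≈ Q i a) eq (lookup-index x∈ a)) (sym (lookup-index y∈ a))

    distinct : ∀ {t t′} (t∈Π : InΠ F P α β t) (t′∈Π : InΠ F P α β t′) →
      ¬ _≈ᵗ_ F t t′ → indices t∈Π ≢ indices t′∈Π
    distinct (p∈ , q∈ , r∈ , _) (p′∈ , q′∈ , r′∈ , _) t≉t′ eq = t≉t′
      ( same-index p∈ p′∈ (cong proj₁ eq)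
      , same-index q∈ q′∈ (cong (proj₁ ∘ proj₂) eq)
      , same-index r∈ r′∈ (cong (proj₂ ∘ proj₂) eq) )

  hyperplane-fibre-length≤ : ∀ {s} → FewerThanOnPlanes F P (suc e) s → ∀ {γ} → ¬ γ ≈ 0# →
    ∀ i (js : List (Fin N)) → Unique js → All (λ j → Q i · Q j ≈ γ) js → length js ≤ pred s
  hyperplane-fibre-length≤ fewer γ≉0 i [] _ _ = z≤n
  hyperplane-fibre-length≤ fewer γ≉0 i js@(j ∷ _) uniq on = ≤-stable λ ≰ →
    ¬¬-chart (Q i) _ (·-nonzeroˡ {p = Q i} {q = Q j} (All.head on) γ≉0) λ H →
    ≰ (onPlane-length≤ fewer (HyperplaneChart.plane H) js uniq (All.map (HyperplaneChart.covers H _) on))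

  hyperplane-bound : ∀ {s} → FewerThanOnPlanes F P (suc e) s → ¬ α ≈ 0# → ¬ β ≈ 0# →
    ∀ I → Unique I → All Good I → length I ≤ N ℕ.* (pred s ℕ.* pred s)
  hyperplane-bound {s} fewer α≉0 β≉0 I uniq good =
    Unique-pairs-length≤ Finₚ._≟_ {P = λ _ → ⊤} N (pred s ℕ.* pred s)
      (λ is uniq _ → Unique-Fin-length≤ is uniq)
      (λ i _ → Unique-pairs-length≤ Finₚ._≟_ (pred s) (pred s)
                 (hyperplane-fibre-length≤ fewer α≉0 i) (λ _ _ → hyperplane-fibre-length≤ fewer β≉0 i))
      I uniq (All.map (tt ,_) good)

  Proportional : Fin N → Fin N → Set (c ⊔ ℓ)
  Proportional j k = ∃ λ κ → κ *ᶠ α ≈ β × _≈ᵖ_ F (Q k) (λ a → κ *ᶠ Q j a)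

  proportional-unique : ¬ α ≈ 0# → ∀ {j k k′} → Proportional j k → Proportional j k′ → k ≡ k′
  proportional-unique α≉0 {j} (κ , κα≈β , Qk≈κQj) (κ′ , κ′α≈β , Qk′≈κ′Qj) = Q-injective λ a → begin
    Q _ a       ≈⟨ Qk≈κQj a ⟩
    κ *ᶠ Q j a  ≈⟨ *-cong (*-cancelʳ-≉0 α≉0 κ κ′ (trans κα≈β (sym κ′α≈β))) refl ⟩
    κ′ *ᶠ Q j a ≈⟨ sym (Qk′≈κ′Qj a) ⟩
    Q _ a       ∎

  codim2-fibre-length≤ : ∀ {t} → FewerThanOnPlanes F P e t → ¬ α ≈ 0# → ∀ j k → ¬ Proportional j k →
    (is : List (Fin N)) → Unique is → All (λ i → Good (i , j , k)) is → length is ≤ pred t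
  codim2-fibre-length≤ fewer α≉0 j k ¬prop [] _ _ = z≤n
  codim2-fibre-length≤ fewer α≉0 j k ¬prop is@(i ∷ _) uniq good = ≤-stable λ ≰ →
    ¬¬-codim2-plane α≉0 (Q i) (proj₁ (All.head good)) (proj₂ (All.head good)) ¬prop λ (Π , on) →
    ≰ (onPlane-length≤ fewer Π is uniq (All.map (λ (x·q≈α , x·r≈β) → on _ x·q≈α x·r≈β) good))

  codim2-bound : ∀ {t} → FewerThanOnPlanes F P e t → ¬ α ≈ 0# →
    ∀ I → Unique I → All Good I → length I ≤ N ℕ.* N ℕ.+ (N ℕ.* N) ℕ.* pred t
  codim2-bound {t} fewer α≉0 I uniq good = ≤-stable λ ≰ →
    ¬¬-∀-Fin N (λ j → ¬¬-∀-Fin N (λ k → ¬¬-excluded-middle)) λ prop? → ≰ (split-by-proportionality prop?)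
    where
    split-by-proportionality : (∀ j k → Dec (Proportional j k)) → length I ≤ N ℕ.* N ℕ.+ (N ℕ.* N) ℕ.* pred t
    split-by-proportionality prop? = subst (_≤ _) (length-filter-partition prop?′ I) (+-mono-≤ proportional-part other-part)
      where
      prop?′ : Decidable (λ ((_ , j , k) : Idx) → Proportional j k)
      prop?′ (_ , j , k) = prop? j k

      drop-k : Idx → Fin N × Fin N
      drop-k (i , j , _) = i , j

      proportional-part : length (filter prop?′ I) ≤ N ℕ.* N
      proportional-part = subst (_≤ _) (length-map drop-k (filter prop?′ I))
        (Unique-Fin²-length≤ _ (map⁺-injectiveOn drop-k
          (λ { {_ , _ , _} {_ , _ , _} prop prop′ ≡.refl → cong (λ k → _ , _ , k) (proportional-unique α≉0 prop prop′) })
          (Unique.filter⁺ prop?′ uniq) (all-filter prop?′ I)))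

      key-first : Idx → (Fin N × Fin N) × Fin N
      key-first (i , jk) = jk , i

      other-part : length (filter (¬? ∘ prop?′) I) ≤ (N ℕ.* N) ℕ.* pred t
      other-part = subst (_≤ _) (length-map key-first (filter (¬? ∘ prop?′) I))
        (Unique-pairs-length≤ (≡-dec Finₚ._≟_ Finₚ._≟_) {P = uncurry λ j k → ¬ Proportional j k} (N ℕ.* N) (pred t)
          (λ jks u _ → Unique-Fin²-length≤ jks u)
          (λ (j , k) ¬prop is u good → codim2-fibre-length≤ fewer α≉0 j k ¬prop is u good)
          _ (Unique.map⁺ (λ { {_ , _} {_ , _} ≡.refl → ≡.refl }) (Unique.filter⁺ (¬? ∘ prop?′) uniq))
          (All.map⁺ (All.map (λ (g , ¬prop) → ¬prop , g)
            (All.zip (All.filter⁺ (¬? ∘ prop?′) good , all-filter (¬? ∘ prop?′) I)))))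

open import Data.Nat using (_*_; _+_; _∸_; _⊓_)
open import Data.Nat.Properties using (≤-refl; ≤-trans; *-mono-≤; pred[n]≤n; m≤n+m; ⊓-glb; ≤-reflexive; module ≤-Reasoning)
open import Data.Nat.Solver using (module +-*-Solver)
open +-*-Solver using (solve; _:=_; _:+_; _:*_; con)

n*pred[s]²≤2*s*s*n : ∀ n s → n * (pred s * pred s) ≤ 2 * s * s * n
n*pred[s]²≤2*s*s*n n s = begin
  n * (pred s * pred s)         ≤⟨ *-mono-≤ {n} ≤-refl (*-mono-≤ (pred[n]≤n {s}) (pred[n]≤n {s})) ⟩
  n * (s * s)                   ≤⟨ m≤n+m (n * (s * s)) (n * (s * s)) ⟩
  n * (s * s) + n * (s * s)     ≡⟨ solve 2 (λ n s → n :* (s :* s) :+ n :* (s :* s) := con 2 :* s :* s :* n) ≡.refl n s ⟩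
  2 * s * s * n                 ∎
  where open ≤-Reasoning

n*n+n*n*pred[t]≡1*t*n*n : ∀ n t → 0 < t → n * n + n * n * pred t ≡ 1 * t * n * n
n*n+n*n*pred[t]≡1*t*n*n n (suc t) _ = solve 2 (λ n t → n :* n :+ n :* n :* t := con 1 :* (con 1 :+ t) :* n :* n) ≡.refl n t

theorem1p5 : ∃ℕω λ C → ∀ {c ℓ} (F : Field c ℓ) (d : ℕ) → 2 ≤ d →
    (n s t : ℕ) (P : List (Point F d)) → DistinctPts F P → length P ≡ n →
    FewerThanOnPlanes F P (d ∸ 1) s → FewerThanOnPlanes F P (d ∸ 2) t →
    (α β : Field.Carrier F) → ¬ (Field._≈_ F α (Field.0# F)) → ¬ (Field._≈_ F β (Field.0# F)) →
    CardΠ≤ F P α β ((2 * s * s * n) ⊓ (C * t * n * n))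
theorem1p5 = 1 ,ω λ
  { F (suc (suc e)) _ _ s t P P-distinct ≡.refl fewer-s fewer-t α β α≉0 β≉0 →
      let open Counting F P P-distinct α β
          0<t : 0 < t
          0<t = fewer-t (AffineGeometry.coordinatePlane F 2 e) [] [] []
      in CardΠ≤-fromIndices λ I uniq good → ⊓-glb
           (≤-trans (hyperplane-bound fewer-s α≉0 β≉0 I uniq good) (n*pred[s]²≤2*s*s*n N s))
           (≤-trans (codim2-bound fewer-t α≉0 I uniq good) (≤-reflexive (n*n+n*n*pred[t]≡1*t*n*n N t 0<t)))
  ; F 0 () ; F 1 (ℕ.s≤s ()) }
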